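{- For any integer $n\ge 2$, the group $\mathcal{M}(n)$ is isomorphic to the symmetric group $S_{n+1}$.
   Context: Let $\mathbf{e}_j$ be the $j$-th standard basis column vector of $\mathbb{Z}^n$ and $\mathbf{r}_h=\big((-1)^h,(-1)^{h+1},\dots,(-1)^{h+n-1}\big)$ a row vector. For $\sigma\in S_n$, $h\in\{1,\dots,n\}$ and $\epsilon\in\{0,1\}$ define $$M(\sigma,h,\epsilon)=\sum_{j=1}^n(-1)^{j+\sigma(j)}\mathbf{e}_j\mathbf{e}_{\sigma(j)}^T+\epsilon\Big((-1)^{h+\sigma(h)+1}\mathbf{e}_h\mathbf{e}_{\sigma(h)}^T+\mathbf{e}_h\mathbf{r}_h\Big).$$ Let $\mathcal{M}(n)=\{M(\sigma,h,\epsilon):\sigma\in S_n,\ 1\le h\le n,\ \epsilon\in\{0,1\}\}$. This set is a group of $(n+1)!$ matrices under matrix multiplication, containing the matrices $K_j=M(\mathrm{id},j,1)=\mathrm{Id}-\mathbf{e}_j\mathbf{e}_j^T+\mathbf{e}_j\mathbf{r}_j$ for $1\le j\le n$. -}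

module Defs where

open import Data.Nat using (ℕ; zero; suc; _+_)
open import Data.Nat.Base using (_%_)
open import Data.Bool using (Bool; true; false; if_then_else_)
open import Data.Fin using (Fin; toℕ; _≟_)
open import Data.Fin.Permutation using (Permutation′; _⟨$⟩ʳ_; _∘ₚ_)
open import Data.Integer using (ℤ; +_; -_; 0ℤ; 1ℤ) renaming (_+_ to _+ℤ_; _*_ to _*ℤ_)
open import Data.Product using (Σ; ∃; _×_; _,_)
open import Relation.Binary.PropositionalEquality using (_≡_)
open import Relation.Nullary.Decidable using (⌊_⌋)

Matrix : ℕ → Set
Matrix n = Fin n → Fin n → ℤ

Vect : ℕ → Set
Vect n = Fin n → ℤ

-- 1-based index of an element of Fin n (the paper indexes 1..n)
idx : ∀ {n} → Fin n → ℕ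
idx i = suc (toℕ i)

sgn : ℕ → ℤ
sgn m with m % 2
... | zero = 1ℤ
... | suc _ = - 1ℤ

δ : ∀ {n} → Fin n → Fin n → ℤ
δ i j = if ⌊ i ≟ j ⌋ then 1ℤ else 0ℤ

e : ∀ {n} → Fin n → Vect n
e j i = δ i j

outer : ∀ {n} → Vect n → Vect n → Matrix n
outer u v i k = u i *ℤ v k

_⊕_ : ∀ {n} → Matrix n → Matrix n → Matrix n
(A ⊕ B) i k = A i k +ℤ B i k

_⊙_ : ∀ {n} → ℤ → Matrix n → Matrix n
(c ⊙ A) i k = c *ℤ A i k

zeroM : ∀ {n} → Matrix n
zeroM i k = 0ℤ

∑ : ∀ {n} {A : Set} → (Fin n → A) → (A → A → A) → A → A
∑ {zero} f _∙_ z = z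
∑ {suc n} f _∙_ z = f Fin.zero ∙ ∑ (λ i → f (Fin.suc i)) _∙_ z
  where import Data.Fin as Fin

sumℤ : ∀ {n} → (Fin n → ℤ) → ℤ
sumℤ f = ∑ f _+ℤ_ 0ℤ

sumM : ∀ {n m} → (Fin m → Matrix n) → Matrix n
sumM f = ∑ f _⊕_ zeroM

_·_ : ∀ {n} → Matrix n → Matrix n → Matrix n
(A · B) i k = sumℤ (λ j → A i j *ℤ B j k)

_≈M_ : ∀ {n} → Matrix n → Matrix n → Set
A ≈M B = ∀ i k → A i k ≡ B i k

-- r_h = ((-1)^h, (-1)^{h+1}, …, (-1)^{h+n-1}); its k-th entry (k 1-based) is (-1)^{h+k-1}
r : ∀ {n} → Fin n → Vect n
r h k = sgn (idx h + toℕ k)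

εℤ : Bool → ℤ
εℤ false = 0ℤ
εℤ true = 1ℤ

Mat : ∀ {n} → Permutation′ n → Fin n → Bool → Matrix n
Mat σ h ε =
  sumM (λ j → sgn (idx j + idx (σ ⟨$⟩ʳ j)) ⊙ outer (e j) (e (σ ⟨$⟩ʳ j)))
  ⊕ (εℤ ε ⊙ ((sgn (idx h + idx (σ ⟨$⟩ʳ h) + 1) ⊙ outer (e h) (e (σ ⟨$⟩ʳ h)))
             ⊕ outer (e h) (r h)))

In𝓜 : ∀ {n} → Matrix n → Set
In𝓜 {n} A = Σ (Permutation′ n) λ σ → Σ (Fin n) λ h → Σ Bool λ ε → A ≈M Mat σ h ε

_≈P_ : ∀ {n} → Permutation′ n → Permutation′ n → Set
π ≈P ρ = ∀ i → π ⟨$⟩ʳ i ≡ ρ ⟨$⟩ʳ i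

record IsoSym𝓜 (m n : ℕ) : Set where
  field
    φ        : Permutation′ m → Matrix n
    into     : ∀ π → In𝓜 (φ π)
    resp     : ∀ π ρ → π ≈P ρ → φ π ≈M φ ρ
    injective : ∀ π ρ → φ π ≈M φ ρ → π ≈P ρ
    surjective : ∀ A → In𝓜 A → Σ (Permutation′ m) λ π → φ π ≈M A
    -- note: π ∘ₚ ρ applies π first, so ρ ∘ₚ π is the usual composition π ∘ ρ
    homo     : ∀ π ρ → φ (ρ ∘ₚ π) ≈M (φ π · φ ρ)

{-# OPTIONS --safe #-}
-- Put cⱼ = (-1)ʲ for 1 ≤ j ≤ n, v₀ = -c and vⱼ = cⱼ eⱼ.  These n+1 row vectors
-- sum to zero and any n of them form a basis of ℤⁿ, so every permutation π of
-- {0,…,n} induces a unique linear map vᵧ ↦ v_{π⁻¹ y}; its matrix has rows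
-- cᵢ v_{π⁻¹ i}, and π ↦ matrix is an injective homomorphism.  That matrix is
-- M(σ,h,ε): ε = 1 exactly when some row h is sent to v₀, and σ records where
-- the other rows go.
module Submission where

open import Defs
open import Data.Nat using (ℕ; suc; _≤_)
import Data.Nat as ℕ
open import Data.Bool using (Bool; true; false)
open import Data.Fin using (Fin; toℕ; _≟_; punchIn) renaming (zero to fz; suc to fs)
open import Data.Fin.Properties using (suc-injective; punchInᵢ≢i)
open import Data.Fin.Permutation
  using (Permutation; Permutation′; _⟨$⟩ʳ_; _⟨$⟩ˡ_; _∘ₚ_; _≈_; flip; lift₀; transpose; remove;
         inverseˡ; inverseʳ; lift₀-remove)
import Data.Fin.Permutation.Components as PC
open import Data.Integer using (ℤ; -_; 0ℤ; 1ℤ; -1ℤ; _+_; _*_)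
import Data.Integer.Properties as ℤP
open import Data.Integer.Tactic.RingSolver using (solve-∀)
open import Algebra.Properties.Semiring.Sum ℤP.+-*-semiring
  using (sum; sum-cong-≗; sum-remove; sum-replicate-zero; sum-permute; *-distribˡ-sum)
open import Algebra.Properties.AbelianGroup ℤP.+-0-abelianGroup using (inverseˡ-unique)
open import Data.Product using (Σ; _,_)
open import Data.Sum using (_⊎_; inj₁; inj₂)
open import Function using (_∘_)
open import Relation.Binary.PropositionalEquality
open import Relation.Nullary using (Dec; yes; no; _because_)
open import Relation.Nullary.Negation using (contradiction)
open import Relation.Nullary.Decidable using (dec-true; dec-false)
open import Relation.Nullary.Reflects using (invert)

open ≡-Reasoning

sgn-suc : ∀ m → sgn (suc m) ≡ - sgn m
sgn-suc 0 = refl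
sgn-suc 1 = refl
sgn-suc (suc (suc m)) = sgn-suc m

sgn-+ : ∀ m n → sgn (m ℕ.+ n) ≡ sgn m * sgn n
sgn-+ 0 n = sym (ℤP.*-identityˡ (sgn n))
sgn-+ (suc m) n = begin
  sgn (suc (m ℕ.+ n))  ≡⟨ sgn-suc (m ℕ.+ n) ⟩
  - sgn (m ℕ.+ n)      ≡⟨ cong -_ (sgn-+ m n) ⟩
  - (sgn m * sgn n)    ≡⟨ ℤP.neg-distribˡ-* (sgn m) (sgn n) ⟩
  - sgn m * sgn n      ≡⟨ cong (_* sgn n) (sgn-suc m) ⟨
  sgn (suc m) * sgn n  ∎

sgn*sgn≡1 : ∀ m → sgn m * sgn m ≡ 1ℤ
sgn*sgn≡1 0 = refl
sgn*sgn≡1 (suc m) = begin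
  sgn (suc m) * sgn (suc m)  ≡⟨ cong₂ _*_ (sgn-suc m) (sgn-suc m) ⟩
  - sgn m * - sgn m          ≡⟨ neg*neg (sgn m) ⟩
  sgn m * sgn m              ≡⟨ sgn*sgn≡1 m ⟩
  1ℤ                         ∎
  where
  neg*neg : ∀ a → - a * - a ≡ a * a
  neg*neg = solve-∀

δ-refl : ∀ {n} (i : Fin n) → δ i i ≡ 1ℤ
δ-refl i with i ≟ i
... | yes _  = refl
... | no i≢i = contradiction refl i≢i

δ-≢ : ∀ {n} {i j : Fin n} → i ≢ j → δ i j ≡ 0ℤ
δ-≢ {i = i} {j} i≢j with i ≟ j
... | yes i≡j = contradiction i≡j i≢j
... | no _    = refl

sumℤ≡sum : ∀ {n} (f : Fin n → ℤ) → sumℤ f ≡ sum f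
sumℤ≡sum {0}     f = refl
sumℤ≡sum {suc n} f = cong (f fz +_) (sumℤ≡sum (f ∘ fs))

sumM-apply : ∀ {m n} (F : Fin m → Matrix n) i k → sumM F i k ≡ sumℤ (λ j → F j i k)
sumM-apply {0}     F i k = refl
sumM-apply {suc m} F i k = cong (F fz i k +_) (sumM-apply (F ∘ fs) i k)

sum-single : ∀ {n} (i : Fin n) (f : Fin n → ℤ) → (∀ j → j ≢ i → f j ≡ 0ℤ) → sum f ≡ f i
sum-single {suc n} i f vanish = begin
  sum f                           ≡⟨ sum-remove f ⟩
  f i + sum (f ∘ punchIn i)       ≡⟨ cong (f i +_) (sum-cong-≗ {n} (λ j → vanish _ (punchInᵢ≢i i j))) ⟩
  f i + sum {n} (λ _ → 0ℤ)        ≡⟨ cong (f i +_) (sum-replicate-zero n) ⟩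
  f i + 0ℤ                        ≡⟨ ℤP.+-identityʳ (f i) ⟩
  f i                             ∎

sumM-outer-e : ∀ {n} (a : Fin n → ℤ) (w : Fin n → Vect n) i k →
               sumM (λ j → a j ⊙ outer (e j) (w j)) i k ≡ a i * w i k
sumM-outer-e a w i k = begin
  sumM (λ j → a j ⊙ outer (e j) (w j)) i k  ≡⟨ sumM-apply (λ j → a j ⊙ outer (e j) (w j)) i k ⟩
  sumℤ (λ j → a j * (δ i j * w j k))        ≡⟨ sumℤ≡sum (λ j → a j * (δ i j * w j k)) ⟩
  sum (λ j → a j * (δ i j * w j k))         ≡⟨ sum-single i _ vanish ⟩
  a i * (δ i i * w i k)                     ≡⟨ cong (λ d → a i * (d * w i k)) (δ-refl i) ⟩
  a i * (1ℤ * w i k)                        ≡⟨ cong (a i *_) (ℤP.*-identityˡ (w i k)) ⟩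
  a i * w i k                               ∎
  where
  vanish : ∀ j → j ≢ i → a j * (δ i j * w j k) ≡ 0ℤ
  vanish j j≢i rewrite δ-≢ (j≢i ∘ sym) = ℤP.*-zeroʳ (a j)

transpose-j : ∀ {n} (i j : Fin n) → PC.transpose i j j ≡ i
transpose-j i j with j ≟ i
... | true because [j≡i] = invert [j≡i]
... | false because _ rewrite dec-true (j ≟ j) refl = refl

transpose-fixes : ∀ {n} {i j k : Fin n} → k ≢ i → k ≢ j → PC.transpose i j k ≡ k
transpose-fixes {i = i} {j} {k} k≢i k≢j rewrite dec-false (k ≟ i) k≢i | dec-false (k ≟ j) k≢j = refl

flip-cong : ∀ {m n} {π ρ : Permutation m n} → π ≈ ρ → flip π ≈ flip ρ
flip-cong {π = π} {ρ} π≈ρ x = begin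
  π ⟨$⟩ˡ x                        ≡⟨ inverseˡ ρ ⟨
  ρ ⟨$⟩ˡ (ρ ⟨$⟩ʳ (π ⟨$⟩ˡ x))      ≡⟨ cong (ρ ⟨$⟩ˡ_) (π≈ρ (π ⟨$⟩ˡ x)) ⟨
  ρ ⟨$⟩ˡ (π ⟨$⟩ʳ (π ⟨$⟩ˡ x))      ≡⟨ cong (ρ ⟨$⟩ˡ_) (inverseʳ π) ⟩
  ρ ⟨$⟩ˡ x                        ∎

≈-on-suc⇒≈ : ∀ {m n} (τ ρ : Permutation (suc m) n) → (∀ i → τ ⟨$⟩ʳ fs i ≡ ρ ⟨$⟩ʳ fs i) → τ ≈ ρ
≈-on-suc⇒≈ τ ρ agree (fs i) = agree i
≈-on-suc⇒≈ τ ρ agree fz with ρ ⟨$⟩ˡ (τ ⟨$⟩ʳ fz) in ρ⁻¹τ0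
... | fz   = trans (sym (inverseʳ ρ)) (cong (ρ ⟨$⟩ʳ_) ρ⁻¹τ0)
... | fs i = contradiction fsi≡fz λ ()
  where
  fsi≡fz : fs i ≡ fz
  fsi≡fz = begin
    fs i                            ≡⟨ inverseˡ τ ⟨
    τ ⟨$⟩ˡ (τ ⟨$⟩ʳ fs i)            ≡⟨ cong (τ ⟨$⟩ˡ_) (agree i) ⟩
    τ ⟨$⟩ˡ (ρ ⟨$⟩ʳ fs i)            ≡⟨ cong (λ y → τ ⟨$⟩ˡ (ρ ⟨$⟩ʳ y)) ρ⁻¹τ0 ⟨
    τ ⟨$⟩ˡ (ρ ⟨$⟩ʳ (ρ ⟨$⟩ˡ (τ ⟨$⟩ʳ fz)))  ≡⟨ cong (τ ⟨$⟩ˡ_) (inverseʳ ρ) ⟩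
    τ ⟨$⟩ˡ (τ ⟨$⟩ʳ fz)              ≡⟨ inverseˡ τ ⟩
    fz                              ∎

-- rep π is the matrix, acting on row vectors, of the linear map vertex y ↦ vertex (π⁻¹ y).
module SignedStandardRepresentation {n : ℕ} (c : Fin n → ℤ) (c*c≡1 : ∀ j → c j * c j ≡ 1ℤ) where

  vertex : Fin (suc n) → Vect n
  vertex fz     k = - c k
  vertex (fs j) k = c j * δ k j

  rep : Permutation′ (suc n) → Matrix n
  rep π i k = c i * vertex (π ⟨$⟩ˡ fs i) k

  c*[c*a]≡a : ∀ j a → c j * (c j * a) ≡ a
  c*[c*a]≡a j a = begin
    c j * (c j * a)  ≡⟨ ℤP.*-assoc (c j) (c j) a ⟨
    c j * c j * a    ≡⟨ cong (_* a) (c*c≡1 j) ⟩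
    1ℤ * a           ≡⟨ ℤP.*-identityˡ a ⟩
    a                ∎

  c-cancel : ∀ j {a b} → c j * a ≡ c j * b → a ≡ b
  c-cancel j {a} {b} eq = begin
    a                ≡⟨ c*[c*a]≡a j a ⟨
    c j * (c j * a)  ≡⟨ cong (c j *_) eq ⟩
    c j * (c j * b)  ≡⟨ c*[c*a]≡a j b ⟩
    b                ∎

  c≢0 : ∀ j → c j ≢ 0ℤ
  c≢0 j cj≡0 = contradiction (trans (sym (c*c≡1 j)) (cong (λ x → x * x) cj≡0)) λ ()

  -c≢c : ∀ j → - c j ≢ c j
  -c≢c j -cj≡cj = contradiction -1≡1 λ ()
    where
    -1≡1 : -1ℤ ≡ 1ℤ
    -1≡1 = begin
      - 1ℤ             ≡⟨ cong -_ (c*c≡1 j) ⟨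
      - (c j * c j)    ≡⟨ ℤP.neg-distribʳ-* (c j) (c j) ⟩
      c j * - c j      ≡⟨ cong (c j *_) -cj≡cj ⟩
      c j * c j        ≡⟨ c*c≡1 j ⟩
      1ℤ               ∎

  vertex-suc-self : ∀ j → vertex (fs j) j ≡ c j
  vertex-suc-self j = trans (cong (c j *_) (δ-refl j)) (ℤP.*-identityʳ (c j))

  vertex-suc-other : ∀ {j k} → k ≢ j → vertex (fs j) k ≡ 0ℤ
  vertex-suc-other {j} k≢j = trans (cong (c j *_) (δ-≢ k≢j)) (ℤP.*-zeroʳ (c j))

  vertex-sum : ∀ k → sum (λ y → vertex y k) ≡ 0ℤ
  vertex-sum k = begin
    - c k + sum (λ j → vertex (fs j) k)
      ≡⟨ cong (- c k +_) (sum-single k _ (λ j j≢k → vertex-suc-other (j≢k ∘ sym))) ⟩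
    - c k + vertex (fs k) k              ≡⟨ cong (- c k +_) (vertex-suc-self k) ⟩
    - c k + c k                          ≡⟨ ℤP.+-inverseˡ (c k) ⟩
    0ℤ                                   ∎

  vertex-injective : ∀ {y y′} → (∀ k → vertex y k ≡ vertex y′ k) → y ≡ y′
  vertex-injective {fz}   {fz}    _  = refl
  vertex-injective {fz}   {fs j}  eq = contradiction (trans (eq j) (vertex-suc-self j)) (-c≢c j)
  vertex-injective {fs j} {fz}    eq = contradiction (trans (sym (eq j)) (vertex-suc-self j)) (-c≢c j)
  vertex-injective {fs j} {fs j′} eq with j ≟ j′
  ... | yes j≡j′ = cong fs j≡j′
  ... | no j≢j′  =
    contradiction (trans (sym (vertex-suc-self j)) (trans (eq j) (vertex-suc-other j≢j′))) (c≢0 j)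

  rep-acts-on-vertex : ∀ ρ y k → sum (λ j → vertex y j * rep ρ j k) ≡ vertex (ρ ⟨$⟩ˡ y) k
  rep-acts-on-vertex ρ (fs j₀) k = begin
    sum (λ j → vertex (fs j₀) j * rep ρ j k)  ≡⟨ sum-single j₀ _ vanish ⟩
    vertex (fs j₀) j₀ * rep ρ j₀ k            ≡⟨ cong (_* rep ρ j₀ k) (vertex-suc-self j₀) ⟩
    c j₀ * rep ρ j₀ k                         ≡⟨ c*[c*a]≡a j₀ _ ⟩
    vertex (ρ ⟨$⟩ˡ fs j₀) k                   ∎
    where
    vanish : ∀ j → j ≢ j₀ → vertex (fs j₀) j * rep ρ j k ≡ 0ℤ
    vanish j j≢j₀ = trans (cong (_* rep ρ j k) (vertex-suc-other j≢j₀)) (ℤP.*-zeroˡ (rep ρ j k))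
  rep-acts-on-vertex ρ fz k = begin
    sum (λ j → - c j * (c j * X j))  ≡⟨ sum-cong-≗ {n} (λ j → -c*[c*a]≡-1*a j (X j)) ⟩
    sum (λ j → -1ℤ * X j)            ≡⟨ *-distribˡ-sum -1ℤ X ⟨
    -1ℤ * sum X                      ≡⟨ ℤP.-1*i≡-i (sum X) ⟩
    - sum X                          ≡⟨ inverseˡ-unique (vertex (ρ ⟨$⟩ˡ fz) k) (sum X) vertex-sum-permuted ⟨
    vertex (ρ ⟨$⟩ˡ fz) k             ∎
    where
    X : Fin n → ℤ
    X j = vertex (ρ ⟨$⟩ˡ fs j) k
    -c*[c*a]≡-1*a : ∀ j a → - c j * (c j * a) ≡ -1ℤ * a
    -c*[c*a]≡-1*a j a = begin
      - c j * (c j * a)    ≡⟨ ℤP.*-assoc (- c j) (c j) a ⟨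
      - c j * c j * a      ≡⟨ cong (_* a) (ℤP.neg-distribˡ-* (c j) (c j)) ⟨
      - (c j * c j) * a    ≡⟨ cong (λ x → - x * a) (c*c≡1 j) ⟩
      -1ℤ * a              ∎
    vertex-sum-permuted : vertex (ρ ⟨$⟩ˡ fz) k + sum X ≡ 0ℤ
    vertex-sum-permuted = trans (sym (sum-permute (λ y → vertex y k) (flip ρ))) (vertex-sum k)

  rep-homo : ∀ π ρ → rep (ρ ∘ₚ π) ≈M (rep π · rep ρ)
  rep-homo π ρ i k = begin
    c i * vertex (ρ ⟨$⟩ˡ y) k                     ≡⟨ cong (c i *_) (rep-acts-on-vertex ρ y k) ⟨
    c i * sum (λ j → vertex y j * rep ρ j k)      ≡⟨ *-distribˡ-sum (c i) (λ j → vertex y j * rep ρ j k) ⟩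
    sum (λ j → c i * (vertex y j * rep ρ j k))    ≡⟨ sum-cong-≗ {n} (λ j → ℤP.*-assoc (c i) _ _) ⟨
    sum (λ j → rep π i j * rep ρ j k)             ≡⟨ sumℤ≡sum (λ j → rep π i j * rep ρ j k) ⟨
    (rep π · rep ρ) i k                           ∎
    where
    y = π ⟨$⟩ˡ fs i

  rep-cong : ∀ {π ρ} → flip π ≈ flip ρ → rep π ≈M rep ρ
  rep-cong π⁻¹≈ρ⁻¹ i k = cong (λ y → c i * vertex y k) (π⁻¹≈ρ⁻¹ (fs i))

  rep-injective : ∀ {π ρ} → rep π ≈M rep ρ → π ≈ ρ
  rep-injective {π} {ρ} eq = flip-cong {π = flip π} {flip ρ}
    (≈-on-suc⇒≈ (flip π) (flip ρ) λ i → vertex-injective (c-cancel i ∘ eq i))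

sign : ∀ {n} → Fin n → ℤ
sign i = sgn (idx i)

open module SignedRep {n} = SignedStandardRepresentation {n} sign (sgn*sgn≡1 ∘ idx)

sign*vertex-suc : ∀ {n} (i j k : Fin n) → sign i * vertex (fs j) k ≡ sgn (idx i ℕ.+ idx j) * δ k j
sign*vertex-suc i j k = begin
  sign i * (sign j * δ k j)      ≡⟨ ℤP.*-assoc (sign i) (sign j) (δ k j) ⟨
  sign i * sign j * δ k j        ≡⟨ cong (_* δ k j) (sgn-+ (idx i) (idx j)) ⟨
  sgn (idx i ℕ.+ idx j) * δ k j  ∎

sign*vertex-zero : ∀ {n} (i k : Fin n) → sign i * vertex fz k ≡ r i k
sign*vertex-zero i k = begin
  sign i * - sgn (suc (toℕ k))  ≡⟨ cong (λ x → sign i * - x) (sgn-suc (toℕ k)) ⟩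
  sign i * - - sgn (toℕ k)      ≡⟨ cong (sign i *_) (ℤP.neg-involutive (sgn (toℕ k))) ⟩
  sign i * sgn (toℕ k)          ≡⟨ sgn-+ (idx i) (toℕ k) ⟨
  r i k                         ∎

module _ {n} (σ : Permutation′ n) (h : Fin n) where

  private
    signedPerm : Matrix n
    signedPerm = sumM (λ j → sgn (idx j ℕ.+ idx (σ ⟨$⟩ʳ j)) ⊙ outer (e j) (e (σ ⟨$⟩ʳ j)))

    correction : Matrix n
    correction = (sgn (idx h ℕ.+ idx (σ ⟨$⟩ʳ h) ℕ.+ 1) ⊙ outer (e h) (e (σ ⟨$⟩ʳ h)))
                 ⊕ outer (e h) (r h)

  Mat-row : ∀ ε i k → ε ≡ false ⊎ i ≢ h →
            Mat σ h ε i k ≡ sgn (idx i ℕ.+ idx (σ ⟨$⟩ʳ i)) * δ k (σ ⟨$⟩ʳ i)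
  Mat-row ε i k ordinary = begin
    signedPerm i k + εℤ ε * correction i k
      ≡⟨ cong (signedPerm i k +_) (correction-vanishes ordinary) ⟩
    signedPerm i k + 0ℤ
      ≡⟨ ℤP.+-identityʳ (signedPerm i k) ⟩
    signedPerm i k
      ≡⟨ sumM-outer-e (λ j → sgn (idx j ℕ.+ idx (σ ⟨$⟩ʳ j))) (e ∘ (σ ⟨$⟩ʳ_)) i k ⟩
    sgn (idx i ℕ.+ idx (σ ⟨$⟩ʳ i)) * δ k (σ ⟨$⟩ʳ i)
      ∎
    where
    correction-vanishes : ε ≡ false ⊎ i ≢ h → εℤ ε * correction i k ≡ 0ℤ
    correction-vanishes (inj₁ refl) = ℤP.*-zeroˡ (correction i k)
    correction-vanishes (inj₂ i≢h) rewrite δ-≢ i≢h =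
      vanish (εℤ ε) (sgn (idx h ℕ.+ idx (σ ⟨$⟩ʳ h) ℕ.+ 1)) (δ k (σ ⟨$⟩ʳ h)) (r h k)
      where
      vanish : ∀ x s d t → x * (s * (0ℤ * d) + 0ℤ * t) ≡ 0ℤ
      vanish = solve-∀

  Mat-pivot-row : ∀ k → Mat σ h true h k ≡ r h k
  Mat-pivot-row k = begin
    signedPerm h k + 1ℤ * (sgn (a ℕ.+ 1) * (δ h h * d) + δ h h * r h k)
      ≡⟨ cong₂ (λ p x → p + 1ℤ * (sgn (a ℕ.+ 1) * (x * d) + x * r h k))
               (sumM-outer-e (λ j → sgn (idx j ℕ.+ idx (σ ⟨$⟩ʳ j))) (e ∘ (σ ⟨$⟩ʳ_)) h k) (δ-refl h) ⟩
    sgn a * d + 1ℤ * (sgn (a ℕ.+ 1) * (1ℤ * d) + 1ℤ * r h k)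
      ≡⟨ cong (λ s → sgn a * d + 1ℤ * (s * (1ℤ * d) + 1ℤ * r h k)) (sgn-+ a 1) ⟩
    sgn a * d + 1ℤ * (sgn a * - 1ℤ * (1ℤ * d) + 1ℤ * r h k)
      ≡⟨ cancel (sgn a) d (r h k) ⟩
    r h k ∎
    where
    a = idx h ℕ.+ idx (σ ⟨$⟩ʳ h)
    d = δ k (σ ⟨$⟩ʳ h)
    cancel : ∀ x d t → x * d + 1ℤ * (x * - 1ℤ * (1ℤ * d) + 1ℤ * t) ≡ t
    cancel = solve-∀

extend : ∀ {n} → Permutation′ n → Fin n → Bool → Permutation′ (suc n)
extend σ h false = lift₀ σ
extend σ h true  = transpose fz (fs h) ∘ₚ lift₀ σ

-- h is irrelevant when ε = false; the Fin n argument supplies one.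
extend-surjective : ∀ {n} (τ : Permutation′ (suc n)) → Fin n →
                    Σ (Permutation′ n) λ σ → Σ (Fin n) λ h → Σ Bool λ ε → τ ≈ extend σ h ε
extend-surjective τ h₀ with τ ⟨$⟩ˡ fz in τ⁻¹0
... | fz   = remove fz τ , h₀ , false , λ x → sym (lift₀-remove τ τ0≡0 x)
  where
  τ0≡0 : τ ⟨$⟩ʳ fz ≡ fz
  τ0≡0 = trans (cong (τ ⟨$⟩ʳ_) (sym τ⁻¹0)) (inverseʳ τ)
... | fs h = remove fz τ′ , h , true , λ x →
  sym (trans (lift₀-remove τ′ τ′0≡0 (t ⟨$⟩ʳ x)) (cong (τ ⟨$⟩ʳ_) (inverseˡ t)))
  where
  t = transpose fz (fs h)
  τ′ = flip t ∘ₚ τ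
  τ′0≡0 : τ′ ⟨$⟩ʳ fz ≡ fz
  τ′0≡0 = trans (cong (τ ⟨$⟩ʳ_) (sym τ⁻¹0)) (inverseʳ τ)

Mat≈rep-extend : ∀ {n} (σ : Permutation′ n) h ε → Mat σ h ε ≈M rep (flip (extend σ h ε))
Mat≈rep-extend σ h false i k =
  trans (Mat-row σ h false i k (inj₁ refl)) (sym (sign*vertex-suc i (σ ⟨$⟩ʳ i) k))
Mat≈rep-extend σ h true i k = by-cases (i ≟ h)
  where
  by-cases : Dec (i ≡ h) → Mat σ h true i k ≡ rep (flip (extend σ h true)) i k
  by-cases (yes refl) = begin
    Mat σ h true h k                    ≡⟨ Mat-pivot-row σ h k ⟩
    r h k                               ≡⟨ sign*vertex-zero h k ⟨
    sign h * vertex fz k                ≡⟨ cong (λ y → sign h * vertex (lift₀ σ ⟨$⟩ʳ y) k) (transpose-j fz (fs h)) ⟨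
    rep (flip (extend σ h true)) h k    ∎
  by-cases (no i≢h) = begin
    Mat σ h true i k                    ≡⟨ Mat-row σ h true i k (inj₂ i≢h) ⟩
    sgn (idx i ℕ.+ idx (σ ⟨$⟩ʳ i)) * δ k (σ ⟨$⟩ʳ i)
                                        ≡⟨ sign*vertex-suc i (σ ⟨$⟩ʳ i) k ⟨
    sign i * vertex (fs (σ ⟨$⟩ʳ i)) k   ≡⟨ cong (λ y → sign i * vertex (lift₀ σ ⟨$⟩ʳ y) k)
                                                (transpose-fixes {i = fz} {fs h} (λ ()) (i≢h ∘ suc-injective)) ⟨
    rep (flip (extend σ h true)) i k    ∎

theorem5p1 : (n : ℕ) → 2 ≤ n → IsoSym𝓜 (suc n) n
theorem5p1 (suc n) _ = record
  { φ          = rep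
  ; into       = into
  ; resp       = λ π ρ π≈ρ → rep-cong {π = π} {ρ = ρ} (flip-cong {π = π} {ρ} π≈ρ)
  ; injective  = λ π ρ → rep-injective {π = π} {ρ = ρ}
  ; surjective = surjective
  ; homo       = rep-homo
  }
  where
  into : ∀ π → In𝓜 (rep π)
  into π with extend-surjective (flip π) fz
  ... | σ , h , ε , π⁻¹≈ = σ , h , ε , λ i k →
    trans (rep-cong {π = π} {ρ = flip (extend σ h ε)} π⁻¹≈ i k) (sym (Mat≈rep-extend σ h ε i k))

  surjective : ∀ A → In𝓜 A → Σ (Permutation′ (suc (suc n))) λ π → rep π ≈M A
  surjective A (σ , h , ε , A≈Mat) = flip (extend σ h ε) , λ i k →
    trans (sym (Mat≈rep-extend σ h ε i k)) (sym (A≈Mat i k))
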